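{- For any odd integers $3\leq \ell < k$ we have $\mathrm{ex}(n,C_{\ell},C_{k})=o(n^{\ell})$ as $n\to\infty$.
   Context: $C_m$ denotes the cycle of length $m$. For graphs $T,H$, $\mathrm{ex}(n,T,H)$ is the maximum number of copies of $T$ in an $H$-free graph on $n$ vertices. -}

module Defs where

open import Data.Nat using (ℕ; zero; suc; _+_; _*_; _/_)
open import Data.Bool using (Bool; true; false; _∧_; not)
open import Data.Fin using (Fin)
open import Data.Fin.Properties using (_≟_)
open import Data.Vec using (Vec; []; _∷_)
open import Data.List using (List; [_]; concatMap; map; filterᵇ; length; allFin)
open import Data.Product using (∃)
open import Relation.Nullary.Decidable using (⌊_⌋)
open import Relation.Binary.PropositionalEquality using (_≡_)

Odd : ℕ → Set
Odd n = ∃ λ j → n ≡ suc (2 * j)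

record Graph (n : ℕ) : Set where
  field
    adj    : Fin n → Fin n → Bool
    sym    : ∀ i j → adj i j ≡ adj j i
    irrefl : ∀ i → adj i i ≡ false
open Graph public

allVecs : (n m : ℕ) → List (Vec (Fin n) m)
allVecs n zero    = [ [] ]
allVecs n (suc m) = concatMap (λ i → map (i ∷_) (allVecs n m)) (allFin n)

notIn : ∀ {n m} → Fin n → Vec (Fin n) m → Bool
notIn x []       = true
notIn x (y ∷ ys) = not ⌊ x ≟ y ⌋ ∧ notIn x ys

distinct : ∀ {n m} → Vec (Fin n) m → Bool
distinct []       = true
distinct (x ∷ xs) = notIn x xs ∧ distinct xs

closedWalk : ∀ {n m} → Graph n → Fin n → Fin n → Vec (Fin n) m → Bool
closedWalk G s x []       = adj G x s
closedWalk G s x (y ∷ ys) = adj G x y ∧ closedWalk G s y ys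

-- v₀ v₁ … v_{m-1} v₀ is a cycle in G (for m ≥ 3): distinct vertices,
-- v_i ~ v_{i+1} and v_{m-1} ~ v₀.  This is an injective homomorphism C_m → G.
isCycleEmb : ∀ {n m} → Graph n → Vec (Fin n) m → Bool
isCycleEmb G []       = false
isCycleEmb G (x ∷ xs) = distinct (x ∷ xs) ∧ closedWalk G x x xs

embeddings : ∀ {n} → (m : ℕ) → Graph n → ℕ
embeddings {n} m G = length (filterᵇ (isCycleEmb G) (allVecs n m))

-- number of copies (subgraphs isomorphic to C_m) of C_m in G, m ≥ 3:
-- each copy corresponds to exactly |Aut(C_m)| = 2m labelled embeddings
copies : ∀ {n} → (m : ℕ) → Graph n → ℕ
copies zero    G = 0
copies (suc m) G = embeddings (suc m) G / (2 * suc m)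

CFree : ∀ {n} → ℕ → Graph n → Set
CFree {n} k G = ∀ (v : Vec (Fin n) k) → isCycleEmb G v ≡ false

{-# OPTIONS --safe #-}

-- Fix the last ℓ − 2 vertices t = v … of a labelled ℓ-cycle. Its first two vertices a, b form an
-- edge between A, the vertices adjacent to the far end of t, and B, the neighbours of v; so at most
-- e(A, B) labelled cycles pass through t. If e(A, B) > k (|A| + |B|), repeatedly deleting vertices
-- of degree < k keeps the bipartite graph dense and ends in a nonempty core in which every vertex
-- has at least k neighbours on the other side. There t extends greedily to a path running
-- alternately through B and A, and as k − ℓ is even it closes up into a C_k. Hence a C_k-free graph
-- has at most 2k n · n^(ℓ−2) labelled ℓ-cycles, which is o(n^ℓ).

module Submission where

open import Defs hiding (sym)
import Algebra.Properties.Semiring.Sum as Sum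
open import Data.Bool using (Bool; true; false; _∧_; not; T)
open import Data.Bool.Properties using (T-∧)
open import Data.Fin using (Fin; zero; suc)
open import Data.Fin.Properties using (_≟_; any?)
open import Data.List using (List; []; _∷_; _++_; map; concat; filterᵇ; length; tabulate)
open import Data.List.Properties using (filter-++; length-++; map-tabulate)
open import Data.Nat using (ℕ; zero; suc; _+_; _*_; _^_; _≤_; _<_; z≤n; s≤s; z<s; _<?_)
open import Data.Nat.DivMod using (m/n≤m)
open import Data.Nat.Properties hiding (_≟_)
open import Data.Nat.Tactic.RingSolver using (solve-∀)
open import Data.Product using (∃; _×_; _,_; proj₁; proj₂)
open import Data.Vec using (Vec; []; _∷_)
open import Function using (_∘_; Equivalence)
open import Relation.Nullary using (yes; no; contradiction)
open import Relation.Nullary.Decidable using (⌊_⌋; ⌊⌋-map′; T?; _×-dec_)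
open import Relation.Binary.PropositionalEquality

open import Algebra.Properties.CommutativeSemigroup +-commutativeSemigroup using (x∙yz≈y∙xz)
open Sum +-*-semiring using (sum-syntax; ∑-comm; *-distribˡ-sum) renaming (sum-cong-≗ to ∑-cong)

∧-intro : ∀ {x y} → T x → T y → T (x ∧ y)
∧-intro p q = Equivalence.from T-∧ (p , q)

∧-elim : ∀ {x y} → T (x ∧ y) → T x × T y
∧-elim = Equivalence.to T-∧

𝟙 : Bool → ℕ
𝟙 true  = 1
𝟙 false = 0

𝟙≤1 : ∀ x → 𝟙 x ≤ 1
𝟙≤1 true  = ≤-refl
𝟙≤1 false = z≤n

𝟙-T : ∀ {x} → T x → 𝟙 x ≡ 1
𝟙-T {true} _ = refl

𝟙-∧ : ∀ x y → 𝟙 (x ∧ y) ≡ 𝟙 x * 𝟙 y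
𝟙-∧ true  y = sym (*-identityˡ (𝟙 y))
𝟙-∧ false y = refl

𝟙-pos : ∀ {x} → 0 < 𝟙 x → T x
𝟙-pos {true} _ = _

𝟙*-pos : ∀ x {d} → 0 < 𝟙 x * d → T x
𝟙*-pos true _ = _

∑-mono-≤ : ∀ {n} {f g : Fin n → ℕ} → (∀ i → f i ≤ g i) → ∑[ i < n ] f i ≤ ∑[ i < n ] g i
∑-mono-≤ {zero}  f≤g = z≤n
∑-mono-≤ {suc n} f≤g = +-mono-≤ (f≤g zero) (∑-mono-≤ (f≤g ∘ suc))

∑-const : ∀ n c → ∑[ i < n ] c ≡ n * c
∑-const zero    c = refl
∑-const (suc n) c = cong (c +_) (∑-const n c)

∑-pos : ∀ {n} (f : Fin n → ℕ) → 0 < ∑[ i < n ] f i → ∃ λ i → 0 < f i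
∑-pos {suc n} f pos with f zero in eq
... | suc _ = zero , subst (0 <_) (sym eq) z<s
... | zero with ∑-pos (f ∘ suc) pos
...   | i , fi>0 = suc i , fi>0

∑-punch : ∀ {n} (f : Fin n → ℕ) x → ∑[ i < n ] f i ≡ f x + ∑[ i < n ] (𝟙 (not ⌊ i ≟ x ⌋) * f i)
∑-punch {suc n} f zero = cong (f zero +_) (∑-cong λ i → sym (*-identityˡ (f (suc i))))
∑-punch {suc n} f (suc x) = begin
  f zero + ∑[ i < n ] f (suc i)
    ≡⟨ cong (f zero +_) (∑-punch (f ∘ suc) x) ⟩
  f zero + (f (suc x) + ∑[ i < n ] (𝟙 (not ⌊ i ≟ x ⌋) * f (suc i)))
    ≡⟨ x∙yz≈y∙xz (f zero) (f (suc x)) _ ⟩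
  f (suc x) + (f zero + ∑[ i < n ] (𝟙 (not ⌊ i ≟ x ⌋) * f (suc i)))
    ≡⟨ cong₂ (λ u v → f (suc x) + (u + v)) (sym (*-identityˡ (f zero))) (∑-cong λ i →
         cong (λ b → 𝟙 (not b) * f (suc i)) (sym (⌊⌋-map′ _ _ (i ≟ x)))) ⟩
  f (suc x) + ∑[ i < suc n ] (𝟙 (not ⌊ i ≟ suc x ⌋) * f i) ∎
  where open ≡-Reasoning

∑ᵥ : ∀ {n} m → (Vec (Fin n) m → ℕ) → ℕ
∑ᵥ zero        f = f []
∑ᵥ {n} (suc m) f = ∑[ i < n ] ∑ᵥ m (f ∘ (i ∷_))

∑ᵥ-≤ : ∀ {n} m {f : Vec (Fin n) m → ℕ} {c} → (∀ v → f v ≤ c) → ∑ᵥ m f ≤ n ^ m * c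
∑ᵥ-≤ zero {c = c} f≤c = subst (_ ≤_) (sym (+-identityʳ c)) (f≤c [])
∑ᵥ-≤ {n} (suc m) {f} {c} f≤c = begin
  ∑[ i < n ] ∑ᵥ m (f ∘ (i ∷_))  ≤⟨ ∑-mono-≤ (λ i → ∑ᵥ-≤ m (f≤c ∘ (i ∷_))) ⟩
  ∑[ i < n ] (n ^ m * c)        ≡⟨ ∑-const n _ ⟩
  n * (n ^ m * c)               ≡⟨ *-assoc n (n ^ m) c ⟨
  n ^ suc m * c                 ∎
  where open ≤-Reasoning

∑-∑ᵥ-comm : ∀ {k n} m (f : Fin k → Vec (Fin n) m → ℕ) →
            ∑[ i < k ] ∑ᵥ m (f i) ≡ ∑ᵥ m (λ v → ∑[ i < k ] f i v)
∑-∑ᵥ-comm zero    f = refl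
∑-∑ᵥ-comm (suc m) f = trans (∑-comm (λ i j → ∑ᵥ m (f i ∘ (j ∷_))))
                            (∑-cong λ j → ∑-∑ᵥ-comm m (λ i → f i ∘ (j ∷_)))

length-filterᵇ-++ : ∀ {A : Set} (P : A → Bool) xs ys →
                    length (filterᵇ P (xs ++ ys)) ≡ length (filterᵇ P xs) + length (filterᵇ P ys)
length-filterᵇ-++ P xs ys = trans (cong length (filter-++ (T? ∘ P) xs ys)) (length-++ (filterᵇ P xs))

length-filterᵇ-map : ∀ {A B : Set} (P : B → Bool) (f : A → B) xs →
                     length (filterᵇ P (map f xs)) ≡ length (filterᵇ (P ∘ f) xs)
length-filterᵇ-map P f []       = refl
length-filterᵇ-map P f (x ∷ xs) with P (f x)
... | true  = cong suc (length-filterᵇ-map P f xs)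
... | false = length-filterᵇ-map P f xs

length-filterᵇ-concat-tabulate : ∀ {A : Set} {n} (P : A → Bool) (g : Fin n → List A) →
  length (filterᵇ P (concat (tabulate g))) ≡ ∑[ i < n ] length (filterᵇ P (g i))
length-filterᵇ-concat-tabulate {n = zero}  P g = refl
length-filterᵇ-concat-tabulate {n = suc n} P g =
  trans (length-filterᵇ-++ P (g zero) _)
        (cong (length (filterᵇ P (g zero)) +_) (length-filterᵇ-concat-tabulate P (g ∘ suc)))

length-filterᵇ-allVecs : ∀ {n} m (P : Vec (Fin n) m → Bool) → length (filterᵇ P (allVecs n m)) ≡ ∑ᵥ m (𝟙 ∘ P)
length-filterᵇ-allVecs zero P with P []
... | true  = refl
... | false = refl
length-filterᵇ-allVecs {n} (suc m) P = begin
  length (filterᵇ P (concat (map extensions (tabulate (λ i → i)))))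
    ≡⟨ cong (length ∘ filterᵇ P ∘ concat) (map-tabulate (λ i → i) extensions) ⟩
  length (filterᵇ P (concat (tabulate extensions)))
    ≡⟨ length-filterᵇ-concat-tabulate P extensions ⟩
  ∑[ i < n ] length (filterᵇ P (map (i ∷_) (allVecs n m)))
    ≡⟨ ∑-cong (λ i → trans (length-filterᵇ-map P (i ∷_) (allVecs n m))
                           (length-filterᵇ-allVecs m (P ∘ (i ∷_)))) ⟩
  ∑ᵥ (suc m) (𝟙 ∘ P) ∎
  where
  open ≡-Reasoning
  extensions : Fin n → List (Vec (Fin n) (suc m))
  extensions i = map (i ∷_) (allVecs n m)

size : ∀ {n} → (Fin n → Bool) → ℕ
size {n} S = ∑[ a < n ] 𝟙 (S a)

size≤n : ∀ {n} (S : Fin n → Bool) → size S ≤ n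
size≤n {n} S = begin
  size S            ≤⟨ ∑-mono-≤ (𝟙≤1 ∘ S) ⟩
  ∑[ a < n ] 1      ≡⟨ ∑-const n 1 ⟩
  n * 1             ≡⟨ *-identityʳ n ⟩
  n                 ∎
  where open ≤-Reasoning

_─_ : ∀ {n} → (Fin n → Bool) → Fin n → Fin n → Bool
(S ─ x) a = S a ∧ not ⌊ a ≟ x ⌋

─-⊆ : ∀ {n} (S : Fin n → Bool) {x a} → T ((S ─ x) a) → T (S a)
─-⊆ S = proj₁ ∘ ∧-elim

𝟙-─ : ∀ {n} (S : Fin n → Bool) x a → 𝟙 (not ⌊ a ≟ x ⌋) * 𝟙 (S a) ≡ 𝟙 ((S ─ x) a)
𝟙-─ S x a = trans (*-comm (𝟙 (not ⌊ a ≟ x ⌋)) (𝟙 (S a))) (sym (𝟙-∧ (S a) _))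

size-─ : ∀ {n} (S : Fin n → Bool) x → size S ≡ 𝟙 (S x) + size (S ─ x)
size-─ S x = trans (∑-punch (𝟙 ∘ S) x) (cong (𝟙 (S x) +_) (∑-cong (𝟙-─ S x)))

size-∈ : ∀ {n} (S : Fin n → Bool) {x} → T (S x) → size S ≡ suc (size (S ─ x))
size-∈ S {x} x∈S = trans (size-─ S x) (cong (_+ size (S ─ x)) (𝟙-T x∈S))

fresh : ∀ {n m} (S : Fin n → Bool) (u : Vec (Fin n) m) → m < size S →
        ∃ λ b → T (S b) × T (notIn b u)
fresh S [] pos with ∑-pos (𝟙 ∘ S) pos
... | b , 0<𝟙Sb = b , 𝟙-pos 0<𝟙Sb , _
fresh S (z ∷ u) m<size with fresh (S ─ z) u (≤-pred (≤-trans m<size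
                                   (≤-trans (≤-reflexive (size-─ S z)) (+-monoˡ-≤ _ (𝟙≤1 (S z))))))
... | b , b∈S─z , b∉u = b , proj₁ (∧-elim b∈S─z) , ∧-intro (proj₂ (∧-elim b∈S─z)) b∉u

module _ {n} (G : Graph n) where

  adj-sym : ∀ {x y} → T (adj G x y) → T (adj G y x)
  adj-sym {x} {y} = subst T (Graph.sym G x y)

  deg : (Fin n → Bool) → Fin n → ℕ
  deg S x = size (λ y → S y ∧ adj G x y)

  fresh-neighbour : ∀ {m} (S : Fin n → Bool) x (u : Vec (Fin n) m) → m < deg S x →
                    ∃ λ y → T (S y) × T (adj G x y) × T (notIn y u)
  fresh-neighbour S x u m<deg with fresh (λ y → S y ∧ adj G x y) u m<deg
  ... | y , y∈S∩N , y∉u = y , proj₁ (∧-elim y∈S∩N) , proj₂ (∧-elim y∈S∩N) , y∉u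

  edges : (Fin n → Bool) → (Fin n → Bool) → ℕ
  edges S R = ∑[ a < n ] (𝟙 (S a) * deg R a)

  edges-comm : ∀ S R → edges S R ≡ edges R S
  edges-comm S R = begin
    ∑[ a < n ] (𝟙 (S a) * deg R a)
      ≡⟨ ∑-cong (λ a → *-distribˡ-sum (𝟙 (S a)) (λ b → 𝟙 (R b ∧ adj G a b))) ⟩
    ∑[ a < n ] ∑[ b < n ] (𝟙 (S a) * 𝟙 (R b ∧ adj G a b))
      ≡⟨ ∑-comm (λ a b → 𝟙 (S a) * 𝟙 (R b ∧ adj G a b)) ⟩
    ∑[ b < n ] ∑[ a < n ] (𝟙 (S a) * 𝟙 (R b ∧ adj G a b))
      ≡⟨ ∑-cong (λ b → ∑-cong (λ a → trans (cong (λ e → 𝟙 (S a) * 𝟙 (R b ∧ e)) (Graph.sym G a b))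
                                              (swap (S a) (R b) _))) ⟩
    ∑[ b < n ] ∑[ a < n ] (𝟙 (R b) * 𝟙 (S a ∧ adj G b a))
      ≡⟨ ∑-cong (λ b → *-distribˡ-sum (𝟙 (R b)) (λ a → 𝟙 (S a ∧ adj G b a))) ⟨
    ∑[ b < n ] (𝟙 (R b) * deg S b) ∎
    where
    open ≡-Reasoning
    swap : ∀ p q e → 𝟙 p * 𝟙 (q ∧ e) ≡ 𝟙 q * 𝟙 (p ∧ e)
    swap true  true  e = refl
    swap true  false e = refl
    swap false true  e = refl
    swap false false e = refl

  edges-─ : ∀ S R {x} → T (S x) → edges S R ≡ deg R x + edges (S ─ x) R
  edges-─ S R {x} x∈S = begin
    edges S R
      ≡⟨ ∑-punch (λ a → 𝟙 (S a) * deg R a) x ⟩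
    𝟙 (S x) * deg R x + ∑[ a < n ] (𝟙 (not ⌊ a ≟ x ⌋) * (𝟙 (S a) * deg R a))
      ≡⟨ cong₂ _+_ (trans (cong (_* deg R x) (𝟙-T x∈S)) (*-identityˡ (deg R x)))
                   (∑-cong λ a → trans (sym (*-assoc (𝟙 (not ⌊ a ≟ x ⌋)) (𝟙 (S a)) (deg R a)))
                                       (cong (_* deg R a) (𝟙-─ S x a))) ⟩
    deg R x + edges (S ─ x) R ∎
    where open ≡-Reasoning

  record Dense (D : ℕ) (S R : Fin n → Bool) : Set where
    constructor dense
    field edges> : D * (size S + size R) < edges S R

  dense-comm : ∀ {D S R} → Dense D S R → Dense D R S
  dense-comm {D} {S} {R} (dense e>) =
    dense (subst₂ (λ s e → D * s < e) (+-comm (size S) (size R)) (edges-comm S R) e>)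

  dense-nonempty : ∀ {D S R} → Dense D S R → ∃ λ a → T (S a)
  dense-nonempty {S = S} {R} (dense e>) with ∑-pos (λ a → 𝟙 (S a) * deg R a) (≤-<-trans z≤n e>)
  ... | a , pos = a , 𝟙*-pos (S a) pos

  dense-─ : ∀ {D S R x} → T (S x) → deg R x < D → Dense D S R → Dense D (S ─ x) R
  dense-─ {D} {S} {R} {x} x∈S low (dense e>) = dense (+-cancelˡ-< D _ _ (begin-strict
    D + D * (size (S ─ x) + size R)   ≡⟨ *-suc D _ ⟨
    D * (suc (size (S ─ x)) + size R) ≡⟨ cong (λ s → D * (s + size R)) (size-∈ S x∈S) ⟨
    D * (size S + size R)             <⟨ e> ⟩
    edges S R                         ≡⟨ edges-─ S R x∈S ⟩
    deg R x + edges (S ─ x) R         ≤⟨ +-monoˡ-≤ _ (<⇒≤ low) ⟩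
    D + edges (S ─ x) R               ∎))
    where open ≤-Reasoning

  record MinDegreeCore (D : ℕ) (S R : Fin n → Bool) : Set where
    field
      left right    : Fin n → Bool
      left⊆S        : ∀ {a} → T (left a) → T (S a)
      right⊆R       : ∀ {b} → T (right b) → T (R b)
      left-deg      : ∀ {a} → T (left a) → D ≤ deg right a
      right-deg     : ∀ {b} → T (right b) → D ≤ deg left b
      left-nonempty : ∃ λ a → T (left a)

  core-mono : ∀ {D S S′ R R′} → (∀ {a} → T (S a) → T (S′ a)) → (∀ {b} → T (R b) → T (R′ b)) →
              MinDegreeCore D S R → MinDegreeCore D S′ R′
  core-mono S⊆S′ R⊆R′ C = record
    { left          = left
    ; right         = right
    ; left⊆S        = λ a∈left → S⊆S′ (left⊆S a∈left)
    ; right⊆R       = λ b∈right → R⊆R′ (right⊆R b∈right)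
    ; left-deg      = left-deg
    ; right-deg     = right-deg
    ; left-nonempty = left-nonempty
    }
    where open MinDegreeCore C

  peel : ∀ {D} fuel S R → size S + size R ≤ fuel → Dense D S R → MinDegreeCore D S R
  peel zero S R bound d with dense-nonempty d
  ... | a , a∈S = contradiction (subst (λ s → s + size R ≤ 0) (size-∈ S a∈S) bound) λ ()
  peel {D} (suc fuel) S R bound d with any? (λ a → T? (S a) ×-dec deg R a <? D)
  ... | yes (x , x∈S , low) =
    core-mono (─-⊆ S) (λ b∈R → b∈R)
      (peel fuel (S ─ x) R (≤-pred (subst (λ s → s + size R ≤ suc fuel) (size-∈ S x∈S) bound))
            (dense-─ x∈S low d))
  ... | no S-high with any? (λ b → T? (R b) ×-dec deg S b <? D)
  ...   | yes (y , y∈R , low) =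
    core-mono (λ a∈S → a∈S) (─-⊆ R)
      (peel fuel S (R ─ y) (≤-pred (subst (_≤ suc fuel) (+-suc (size S) _)
                                   (subst (λ r → size S + r ≤ suc fuel) (size-∈ R y∈R) bound)))
            (dense-comm (dense-─ y∈R low (dense-comm d))))
  ...   | no R-high = record
    { left          = S
    ; right         = R
    ; left⊆S        = λ a∈S → a∈S
    ; right⊆R       = λ b∈R → b∈R
    ; left-deg      = λ a∈S → ≮⇒≥ λ low → S-high (_ , a∈S , low)
    ; right-deg     = λ b∈R → ≮⇒≥ λ low → R-high (_ , b∈R , low)
    ; left-nonempty = dense-nonempty d
    }

  -- Distinctness of t is built in, so that any closer certifies that t is a path.
  closers : ∀ {m} → Vec (Fin n) (suc m) → Fin n → Bool
  closers (v ∷ rest) s = distinct (v ∷ rest) ∧ closedWalk G s v rest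

  module Greedy {D S R} (C : MinDegreeCore D S R) where
    open MinDegreeCore C

    -- Every left vertex is adjacent to the far end of the path, so adding one at the tip closes a
    -- cycle; the path only ever grows at the tip, which preserves this.
    record Path (m : ℕ) : Set where
      field
        tip               : Fin n
        body              : Vec (Fin n) m
        tip∈right         : T (right tip)
        distinct-tip∷body : T (distinct (tip ∷ body))
        closable          : ∀ {s} → T (left s) → T (closedWalk G s tip body)

    initial : ∀ {m} v (rest : Vec (Fin n) m) →
              (∀ {s} → T (S s) → T (closers (v ∷ rest) s)) → (∀ {b} → T (R b) → T (adj G b v)) →
              suc m < D → Path (suc m)
    initial v rest S⊆closers R⊆N m<D =
      let a , a∈left = left-nonempty
          b , b∈right , _ , b∉ = fresh-neighbour right a (v ∷ rest) (<-≤-trans m<D (left-deg a∈left))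
      in record
        { tip               = b
        ; body              = v ∷ rest
        ; tip∈right         = b∈right
        ; distinct-tip∷body = ∧-intro b∉ (proj₁ (∧-elim (S⊆closers (left⊆S a∈left))))
        ; closable          = λ s∈left → ∧-intro (R⊆N (right⊆R b∈right))
                                         (proj₂ (∧-elim (S⊆closers (left⊆S s∈left))))
        }

    grow : ∀ {m} → suc (suc m) < D → Path m → Path (suc (suc m))
    grow m+2<D p =
      let a , a∈left , tip~a , a∉ = fresh-neighbour left tip (tip ∷ body)
                                      (<-≤-trans (≤-trans (n≤1+n _) m+2<D) (right-deg tip∈right))
          b , b∈right , a~b , b∉ = fresh-neighbour right a (a ∷ tip ∷ body)
                                      (<-≤-trans m+2<D (left-deg a∈left))
      in record
        { tip               = b
        ; body              = a ∷ tip ∷ body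
        ; tip∈right         = b∈right
        ; distinct-tip∷body = ∧-intro b∉ (∧-intro a∉ distinct-tip∷body)
        ; closable          = λ s∈left → ∧-intro (adj-sym a~b) (∧-intro (adj-sym tip~a) (closable s∈left))
        }
      where open Path p

    -- j * 2 rather than 2 * j: then suc j * 2 + m reduces to suc (suc (j * 2 + m)), the index grow yields.
    grow* : ∀ j {m} → suc (j * 2 + m) < D → Path m → Path (j * 2 + m)
    grow* zero    _  p = p
    grow* (suc j) lt p = grow (≤-trans (n≤1+n _) lt) (grow* j (≤-trans (m≤n+m _ 2) lt) p)

    close : ∀ {m} → suc m < D → Path m → ∃ λ (w : Vec (Fin n) (suc (suc m))) → T (isCycleEmb G w)
    close m+1<D p =
      let a , a∈left , tip~a , a∉ = fresh-neighbour left tip (tip ∷ body)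
                                      (<-≤-trans m+1<D (right-deg tip∈right))
      in a ∷ tip ∷ body , ∧-intro (∧-intro a∉ distinct-tip∷body) (∧-intro (adj-sym tip~a) (closable a∈left))
      where open Path p

  cycles-through : ∀ {m} → Vec (Fin n) m → ℕ
  cycles-through t = ∑[ a < n ] ∑[ b < n ] 𝟙 (isCycleEmb G (a ∷ b ∷ t))

  cycles-through-≤-edges : ∀ {m} v (rest : Vec (Fin n) m) →
    cycles-through (v ∷ rest) ≤ edges (closers (v ∷ rest)) (λ b → adj G b v)
  cycles-through-≤-edges v rest = begin
    cycles-through (v ∷ rest)
      ≤⟨ ∑-mono-≤ (λ a → ∑-mono-≤ λ b →
           𝟙-bound (notIn a (b ∷ v ∷ rest)) (notIn b (v ∷ rest)) _ (adj G a b) (adj G b v) _) ⟩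
    ∑[ a < n ] ∑[ b < n ] (𝟙 (closers (v ∷ rest) a) * 𝟙 (adj G b v ∧ adj G a b))
      ≡⟨ ∑-cong (λ a → *-distribˡ-sum (𝟙 (closers (v ∷ rest) a)) (λ b → 𝟙 (adj G b v ∧ adj G a b))) ⟨
    edges (closers (v ∷ rest)) (λ b → adj G b v) ∎
    where
    open ≤-Reasoning
    -- p, q, d and x, y, z are the three conjuncts of each half of isCycleEmb G (a ∷ b ∷ v ∷ rest).
    𝟙-bound : ∀ p q d x y z → 𝟙 ((p ∧ (q ∧ d)) ∧ (x ∧ (y ∧ z))) ≤ 𝟙 (d ∧ z) * 𝟙 (y ∧ x)
    𝟙-bound false _     _     _     _     _     = z≤n
    𝟙-bound true  false _     _     _     _     = z≤n
    𝟙-bound true  true  false _     _     _     = z≤n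
    𝟙-bound true  true  true  false _     _     = z≤n
    𝟙-bound true  true  true  true  false _     = z≤n
    𝟙-bound true  true  true  true  true  false = z≤n
    𝟙-bound true  true  true  true  true  true  = ≤-refl

  cycles-through-≤ : ∀ j {m} v (rest : Vec (Fin n) m) → CFree (suc (suc (j * 2 + suc m))) G →
    cycles-through (v ∷ rest) ≤ suc (suc (j * 2 + suc m)) * (n + n)
  cycles-through-≤ j {m} v rest free = begin
    cycles-through (v ∷ rest) ≤⟨ cycles-through-≤-edges v rest ⟩
    edges A B                 ≤⟨ sparse ⟩
    k * (size A + size B)     ≤⟨ *-monoʳ-≤ k (+-mono-≤ (size≤n A) (size≤n B)) ⟩
    k * (n + n)               ∎
    where
    open ≤-Reasoning
    k = suc (suc (j * 2 + suc m))
    A = closers (v ∷ rest)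
    B = λ b → adj G b v
    sparse : edges A B ≤ k * (size A + size B)
    sparse = ≮⇒≥ λ e> →
      let open Greedy (peel {k} _ A B ≤-refl (dense e>))
          w , cycle = close ≤-refl (grow* j ≤-refl (initial v rest (λ s∈A → s∈A) (λ b∈B → b∈B)
                                                      (m≤n⇒m≤1+n (s≤s (m≤n+m (suc m) (j * 2))))))
      in subst T (free w) cycle

embeddings-≤ : ∀ {n} (G : Graph n) j r → let k = j * 2 + (3 + r) in
               CFree k G → embeddings (3 + r) G ≤ (k + k) * n ^ (2 + r)
embeddings-≤ {n} G j r free = begin
  embeddings (3 + r) G
    ≡⟨ length-filterᵇ-allVecs (3 + r) (isCycleEmb G) ⟩
  ∑[ a < n ] ∑[ b < n ] ∑ᵥ (suc r) (λ t → 𝟙 (isCycleEmb G (a ∷ b ∷ t)))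
    ≡⟨ ∑-cong (λ a → ∑-∑ᵥ-comm (suc r) (λ b t → 𝟙 (isCycleEmb G (a ∷ b ∷ t)))) ⟩
  ∑[ a < n ] ∑ᵥ (suc r) (λ t → ∑[ b < n ] 𝟙 (isCycleEmb G (a ∷ b ∷ t)))
    ≡⟨ ∑-∑ᵥ-comm (suc r) (λ a t → ∑[ b < n ] 𝟙 (isCycleEmb G (a ∷ b ∷ t))) ⟩
  ∑ᵥ (suc r) (cycles-through G)
    ≤⟨ ∑ᵥ-≤ (suc r) {cycles-through G} (λ { (v ∷ rest) →
         cycles-through-≤ G j v rest (subst (λ k → CFree k G) k≡ free) }) ⟩
  n ^ suc r * (suc (suc (j * 2 + suc r)) * (n + n))
    ≡⟨ cong (λ k → n ^ suc r * (k * (n + n))) k≡ ⟨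
  n ^ suc r * (k * (n + n))
    ≡⟨ rearrange (n ^ suc r) k n ⟩
  (k + k) * n ^ (2 + r) ∎
  where
  open ≤-Reasoning
  k = j * 2 + (3 + r)
  k≡ : k ≡ suc (suc (j * 2 + suc r))
  k≡ = trans (+-suc (j * 2) (2 + r)) (cong suc (+-suc (j * 2) (suc r)))
  rearrange : ∀ p k n → p * (k * (n + n)) ≡ (k + k) * (n * p)
  rearrange = solve-∀

odd-gap : ∀ {ℓ k} → Odd ℓ → Odd k → ℓ ≤ k → ∃ λ j → k ≡ j * 2 + ℓ
odd-gap (a , refl) (b , refl) (s≤s 2a≤2b) with m≤n⇒∃[o]m+o≡n (*-cancelˡ-≤ {a} {b} 2 2a≤2b)
... | j , refl = j , gap a j
  where
  gap : ∀ a j → suc (2 * (a + j)) ≡ j * 2 + suc (2 * a)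
  gap = solve-∀

lemma2p2 : ∀ (ℓ k : ℕ) → Odd ℓ → Odd k → 3 ≤ ℓ → ℓ < k →
    ∀ (m : ℕ) → 0 < m →
      ∃ λ (N : ℕ) → ∀ (n : ℕ) → N ≤ n →
        ∀ (G : Graph n) → CFree k G → m * copies ℓ G ≤ n ^ ℓ
lemma2p2 ℓ k ℓ-odd k-odd 3≤ℓ ℓ<k m _ with odd-gap ℓ-odd k-odd (<⇒≤ ℓ<k) | m≤n⇒∃[o]m+o≡n 3≤ℓ
... | j , refl | r , refl = m * (k + k) , λ n m[k+k]≤n G free → begin
    m * copies (3 + r) G             ≤⟨ *-monoʳ-≤ m (m/n≤m (embeddings (3 + r) G) (2 * (3 + r))) ⟩
    m * embeddings (3 + r) G         ≤⟨ *-monoʳ-≤ m (embeddings-≤ G j r free) ⟩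
    m * ((k + k) * n ^ (2 + r))      ≡⟨ *-assoc m (k + k) _ ⟨
    m * (k + k) * n ^ (2 + r)        ≤⟨ *-monoˡ-≤ (n ^ (2 + r)) m[k+k]≤n ⟩
    n ^ (3 + r)                      ∎
  where open ≤-Reasoning
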